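{- For a presentation of a pre-d-frame as in the context, ($\lambda^2_+$) holds iff ($\lambda^1_+$) holds, and ($\lambda^2_-$) holds iff ($\lambda^1_-$) holds, where: ($\lambda^1_+$): $\alpha\in\mathcal D(\downarrow\mathsf{con}_{\wedge,\vee})$, $\beta\in\mathsf{tot}_{\wedge,\vee}$, $\beta_+\le\alpha_+$ imply $\alpha_-\le\beta_-$; ($\lambda^1_-$): $\alpha\in\mathcal D(\downarrow\mathsf{con}_{\wedge,\vee})$, $\beta\in\mathsf{tot}_{\wedge,\vee}$, $\beta_-\le\alpha_-$ imply $\alpha_+\le\beta_+$; ($\lambda^2_+$): $\alpha\in\mathcal D(\downarrow\mathsf{con}_{\wedge,\vee})$, $\beta\in\mathsf{tot}_\wedge$, $\beta_+\le\alpha_+$ imply $\alpha_-\le\beta_-$; ($\lambda^2_-$): $\alpha\in\mathcal D(\downarrow\mathsf{con}_{\wedge,\vee})$, $\beta\in\mathsf{tot}_\vee$, $\beta_-\le\alpha_-$ imply $\alpha_+\le\beta_+$.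
   Context: Let $(B_\pm,\mathcal C_\pm)$ be frame presentations ($B$ a meet-semilattice with top, $\mathcal C$ a set of pairs $U\dashv a$ with $a\in B$, $U\subseteq\downarrow a$, stable: $U\dashv a\in\mathcal C$, $b\le a\Rightarrow\{u\wedge b:u\in U\}\dashv b\in\mathcal C$), $L_\pm$ the frame of $\mathcal C_\pm$-ideals (downsets $I$ with $U\dashv a\in\mathcal C,U\subseteq I\Rightarrow a\in I$, ordered by inclusion), $b\in B_\pm$ identified with the smallest $\mathcal C_\pm$-ideal containing it, and $\mathsf{con}_1,\mathsf{tot}_1\subseteq B_+\times B_-\subseteq L_+\times L_-$. On $L_+\times L_-$: $\alpha\sqsubseteq\beta$ iff $\alpha_+\le\beta_+,\alpha_-\le\beta_-$; logical join $(\alpha_+\vee\beta_+,\alpha_-\wedge\beta_-)$, logical meet $(\alpha_+\wedge\beta_+,\alpha_-\vee\beta_-)$. $\mathsf{con}_{\wedge,\vee}$ is the closure of $\mathsf{con}_1$ under finite logical meets and joins; $\mathsf{tot}_\wedge$, $\mathsf{tot}_\vee$, $\mathsf{tot}_{\wedge,\vee}$ are the closures of $\mathsf{tot}_1$ under finite logical meets, finite logical joins, and both. $\downarrow$ is $\sqsubseteq$-downward closure. $\mathcal D(R)=\{(\bigvee_{\alpha\in A}\alpha_+,\bigvee_{\alpha\in A}\alpha_-): A\subseteq R\ \sqsubseteq\text{ -directed}\}$. -}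

module Defs where

open import Level using (Level; suc; Lift)
open import Data.Product using (Σ; ∃; _×_; _,_; proj₁; proj₂)
open import Data.Sum using (_⊎_)
open import Relation.Binary.Lattice using (BoundedMeetSemilattice)

record FramePres (ℓ : Level) : Set (suc ℓ) where
  field
    SL : BoundedMeetSemilattice ℓ ℓ ℓ
  open BoundedMeetSemilattice SL public renaming (Carrier to B)
  field
    Cov        : (B → Set ℓ) → B → Set ℓ
    Cov-below  : ∀ {U a} → Cov U a → ∀ u → U u → u ≤ a
    Cov-stable : ∀ {U a b} → Cov U a → b ≤ a →
                 Cov (λ x → Σ B (λ u → U u × (x ≈ (u ∧ b)))) b

module Ideals {ℓ : Level} (P : FramePres ℓ) where
  open FramePres P

  record Ideal : Set (suc (suc ℓ)) where
    field
      mem    : B → Set (suc ℓ)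
      down   : ∀ {a b} → b ≤ a → mem a → mem b
      closed : ∀ {U a} → Cov U a → (∀ u → U u → mem u) → mem a
  open Ideal public

  _⊆_ : Ideal → Ideal → Set (suc ℓ)
  I ⊆ J = ∀ b → mem I b → mem J b

  _≅_ : Ideal → Ideal → Set (suc ℓ)
  I ≅ J = (I ⊆ J) × (J ⊆ I)

  data Gen (S : B → Set (suc ℓ)) : B → Set (suc ℓ) where
    gen  : ∀ {a} → S a → Gen S a
    gdown : ∀ {a b} → b ≤ a → Gen S a → Gen S b
    gcov : ∀ {U a} → Cov U a → (∀ u → U u → Gen S u) → Gen S a

  genI : (B → Set (suc ℓ)) → Ideal
  genI S = record { mem = Gen S ; down = gdown ; closed = gcov }

  emb : B → Ideal
  emb b = genI (λ x → Lift (suc ℓ) (x ≤ b))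

  _∩_ : Ideal → Ideal → Ideal
  I ∩ J = record
    { mem = λ x → mem I x × mem J x
    ; down = λ p m → down I p (proj₁ m) , down J p (proj₂ m)
    ; closed = λ c h → closed I c (λ u p → proj₁ (h u p)) , closed J c (λ u p → proj₂ (h u p)) }

  _∪_ : Ideal → Ideal → Ideal
  I ∪ J = genI (λ x → mem I x ⊎ mem J x)

  ⋁ : {ι : Set (suc ℓ)} → (ι → Ideal) → Ideal
  ⋁ {ι} f = genI (λ x → Σ ι (λ i → mem (f i) x))

-- L₊ × L₋ with its information order and logical operations.
module Bi {ℓ : Level} (P₊ P₋ : FramePres ℓ) where
  module L₊ = Ideals P₊
  module L₋ = Ideals P₋
  B₊ = FramePres.B P₊
  B₋ = FramePres.B P₋

  Pair : Set (suc (suc ℓ))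
  Pair = L₊.Ideal × L₋.Ideal

  _⊑_ : Pair → Pair → Set (suc ℓ)
  α ⊑ β = (proj₁ α L₊.⊆ proj₁ β) × (proj₂ α L₋.⊆ proj₂ β)

  _≋_ : Pair → Pair → Set (suc ℓ)
  α ≋ β = (α ⊑ β) × (β ⊑ α)

  _⊔_ : Pair → Pair → Pair
  α ⊔ β = (proj₁ α L₊.∪ proj₁ β) , (proj₂ α L₋.∩ proj₂ β)

  _⊓_ : Pair → Pair → Pair
  α ⊓ β = (proj₁ α L₊.∩ proj₁ β) , (proj₂ α L₋.∪ proj₂ β)

  embP : B₊ → B₋ → Pair
  embP b c = L₊.emb b , L₋.emb c

  Subset : Set (suc (suc (suc ℓ)))
  Subset = Pair → Set (suc (suc ℓ))

  data ClMJ (R₁ : B₊ → B₋ → Set ℓ) : Pair → Set (suc (suc ℓ)) where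
    base : ∀ {b c} → R₁ b c → ClMJ R₁ (embP b c)
    meet : ∀ {α β} → ClMJ R₁ α → ClMJ R₁ β → ClMJ R₁ (α ⊓ β)
    join : ∀ {α β} → ClMJ R₁ α → ClMJ R₁ β → ClMJ R₁ (α ⊔ β)

  data ClM (R₁ : B₊ → B₋ → Set ℓ) : Pair → Set (suc (suc ℓ)) where
    base : ∀ {b c} → R₁ b c → ClM R₁ (embP b c)
    meet : ∀ {α β} → ClM R₁ α → ClM R₁ β → ClM R₁ (α ⊓ β)

  data ClJ (R₁ : B₊ → B₋ → Set ℓ) : Pair → Set (suc (suc ℓ)) where
    base : ∀ {b c} → R₁ b c → ClJ R₁ (embP b c)
    join : ∀ {α β} → ClJ R₁ α → ClJ R₁ β → ClJ R₁ (α ⊔ β)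

  upto : Subset → Subset
  upto S α = Σ Pair (λ β → S β × (α ≋ β))

  _∧∨ _∧ _∨ : (B₊ → B₋ → Set ℓ) → Subset
  R ∧∨ = upto (ClMJ R)
  R ∧  = upto (ClM R)
  R ∨  = upto (ClJ R)

  ↓ : Subset → Subset
  ↓ S α = Σ Pair (λ β → S β × (α ⊑ β))

  -- 𝓓(R): joins of ⊑-directed (nonempty) subsets of R, given as families
  Directed : {ι : Set (suc ℓ)} → (ι → Pair) → Set (suc ℓ)
  Directed {ι} f = ι × (∀ i j → Σ ι (λ k → (f i ⊑ f k) × (f j ⊑ f k)))

  𝓓 : Subset → Subset
  𝓓 R α = Σ (Set (suc ℓ)) (λ ι → Σ (ι → Pair) (λ f →
            (∀ i → R (f i)) × Directed f
            × (proj₁ α L₊.≅ L₊.⋁ (λ i → proj₁ (f i)))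
            × (proj₂ α L₋.≅ L₋.⋁ (λ i → proj₂ (f i)))))

  module Conditions (con₁ tot₁ : B₊ → B₋ → Set ℓ) where
    λ¹₊ λ¹₋ λ²₊ λ²₋ : Set (suc (suc ℓ))
    λ¹₊ = ∀ α β → 𝓓 (↓ (con₁ ∧∨)) α → (tot₁ ∧∨) β →
          proj₁ β L₊.⊆ proj₁ α → proj₂ α L₋.⊆ proj₂ β
    λ¹₋ = ∀ α β → 𝓓 (↓ (con₁ ∧∨)) α → (tot₁ ∧∨) β →
          proj₂ β L₋.⊆ proj₂ α → proj₁ α L₊.⊆ proj₁ β
    λ²₊ = ∀ α β → 𝓓 (↓ (con₁ ∧∨)) α → (tot₁ ∧) β →
          proj₁ β L₊.⊆ proj₁ α → proj₂ α L₋.⊆ proj₂ β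
    λ²₋ = ∀ α β → 𝓓 (↓ (con₁ ∧∨)) α → (tot₁ ∨) β →
          proj₂ β L₋.⊆ proj₂ α → proj₁ α L₊.⊆ proj₁ β

module Submission where

-- In each component L± is a distributive lattice, and in the information order
-- on L₊ × L₋ the logical meet distributes over the logical join (and vice
-- versa) up to ⊑.  Hence every β ∈ tot_{∧,∨} lies ⊑-above a finite logical join
-- of elements of tot_∧, and also above a finite logical meet of elements of
-- tot_∨.  The property "β₊ ≤ α₊ implies α₋ ≤ β₋ for all α ∈ 𝓓(↓con_{∧,∨})" is
-- ⊑-upward closed and preserved by logical joins, so (λ²₊) propagates from
-- tot_∧ to tot_{∧,∨}; dually (λ²₋) propagates from tot_∨ along logical meets.

open import Level using (Level) renaming (_⊔_ to _⊔ˡ_; suc to lsuc)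
open import Data.Product using (_×_; _,_; proj₁; proj₂)
open import Data.Sum using (_⊎_; inj₁; inj₂)
open import Function.Bundles using (_⇔_; mk⇔)
open import Algebra.Core using (Op₂)
open import Relation.Binary.Core using (Rel; _Preserves₂_⟶_⟶_)
open import Relation.Binary.Definitions using (Reflexive; Transitive)
open import Relation.Binary.Lattice using (DistributiveLattice)
import Relation.Binary.Lattice.Properties.MeetSemilattice as MeetSemilatticeProperties
import Relation.Binary.Lattice.Properties.DistributiveLattice as DistributiveLatticeProperties
open import Defs

module IdealLattice {ℓ : Level} (P : FramePres ℓ) where
  open FramePres P using (_∧_; x∧y≤x; x∧y≤y; ∧-greatest; meetSemilattice; Cov-stable)
    renaming (refl to ≤-refl; trans to ≤-trans; reflexive to ≤-reflexive)
  open MeetSemilatticeProperties meetSemilattice using (∧-monotonic)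
  open Ideals P

  ∪-least : ∀ I J K → I ⊆ K → J ⊆ K → (I ∪ J) ⊆ K
  ∪-least I J K p q _ = go
    where
    go : ∀ {a} → Gen (λ x → mem I x ⊎ mem J x) a → mem K a
    go (gen (inj₁ m)) = p _ m
    go (gen (inj₂ m)) = q _ m
    go (gdown b≤a g)  = down K b≤a (go g)
    go (gcov cov h)   = closed K cov (λ u u∈U → go (h u u∈U))

  -- Meeting every stage of a derivation of a ∈ J ∪ K with a fixed c ∈ I; the
  -- cover steps survive because covers are stable under meets.
  ∩-distribˡ-∪-⊆ : ∀ I J K → (I ∩ (J ∪ K)) ⊆ ((I ∩ J) ∪ (I ∩ K))
  ∩-distribˡ-∪-⊆ I J K b (b∈I , b∈J∪K) = gdown (∧-greatest ≤-refl ≤-refl) (go b∈I b∈J∪K)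
    where
    go : ∀ {a c} → mem I c → Gen (λ x → mem J x ⊎ mem K x) a →
         Gen (λ x → mem (I ∩ J) x ⊎ mem (I ∩ K) x) (a ∧ c)
    go {a} {c} c∈I (gen (inj₁ a∈J)) = gen (inj₁ (down I (x∧y≤y a c) c∈I , down J (x∧y≤x a c) a∈J))
    go {a} {c} c∈I (gen (inj₂ a∈K)) = gen (inj₂ (down I (x∧y≤y a c) c∈I , down K (x∧y≤x a c) a∈K))
    go c∈I (gdown b≤a g) = gdown (∧-monotonic b≤a ≤-refl) (go c∈I g)
    go {a} {c} c∈I (gcov cov h) =
      gcov (Cov-stable cov (x∧y≤x a c))
           (λ { _ (u , u∈U , x≈u∧a∧c) →
                  gdown (≤-trans (≤-reflexive x≈u∧a∧c) (∧-monotonic ≤-refl (x∧y≤y a c)))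
                        (go c∈I (h u u∈U)) })

  distributiveLattice : DistributiveLattice (lsuc (lsuc ℓ)) (lsuc ℓ) (lsuc ℓ)
  distributiveLattice = record
    { Carrier = Ideal
    ; _≈_ = _≅_
    ; _≤_ = _⊆_
    ; _∨_ = _∪_
    ; _∧_ = _∩_
    ; isDistributiveLattice = record
      { isLattice = record
        { isPartialOrder = record
          { isPreorder = record
            { isEquivalence = record
              { refl = (λ _ m → m) , (λ _ m → m)
              ; sym = λ (p , q) → q , p
              ; trans = λ (p , q) (p' , q') → (λ b m → p' b (p b m)) , (λ b m → q b (q' b m))
              }
            ; reflexive = proj₁
            ; trans = λ p q b m → q b (p b m)
            }
          ; antisym = _,_
          }
        ; supremum = λ I J → (λ _ m → gen (inj₁ m)) , (λ _ m → gen (inj₂ m)) , ∪-least I J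
        ; infimum = λ I J → (λ _ → proj₁) , (λ _ → proj₂) , λ K p q b m → p b m , q b m
        }
      ; ∧-distribˡ-∨ = λ I J K →
          ∩-distribˡ-∪-⊆ I J K ,
          ∪-least (I ∩ J) (I ∩ K) (I ∩ (J ∪ K))
            (λ _ (i , j) → i , gen (inj₁ j)) (λ _ (i , k) → i , gen (inj₂ k))
      }
    }

  ∪-mono : ∀ I I′ J J′ → I ⊆ I′ → J ⊆ J′ → (I ∪ J) ⊆ (I′ ∪ J′)
  ∪-mono I I′ J J′ p q =
    ∪-least I J (I′ ∪ J′) (λ b m → gen (inj₁ (p b m))) (λ b m → gen (inj₂ (q b m)))

  open DistributiveLatticeProperties distributiveLattice public
    using (∧-distribʳ-∨; ∨-distribˡ-∧; ∨-distribʳ-∧)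
  open DistributiveLattice distributiveLattice public using (∧-distribˡ-∨)

module JoinsOfMeets {a r : Level} {X : Set a} (_⊑_ : Rel X r)
  (⊑-refl : Reflexive _⊑_) (⊑-trans : Transitive _⊑_) (_∨_ _∧_ : Op₂ X)
  (∨-mono : _∨_ Preserves₂ _⊑_ ⟶ _⊑_ ⟶ _⊑_) (∧-mono : _∧_ Preserves₂ _⊑_ ⟶ _⊑_ ⟶ _⊑_)
  (∧-distribˡ-∨ : ∀ x y z → ((x ∧ y) ∨ (x ∧ z)) ⊑ (x ∧ (y ∨ z)))
  (∧-distribʳ-∨ : ∀ x y z → ((y ∧ x) ∨ (z ∧ x)) ⊑ ((y ∨ z) ∧ x)) where

  data Joins {p : Level} (M : X → Set p) : X → Set (a ⊔ˡ p) where
    [_]  : ∀ {x} → M x → Joins M x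
    _∨ᴶ_ : ∀ {x y} → Joins M x → Joins M y → Joins M (x ∨ y)

  Joins-closed : ∀ {p q} {M : X → Set p} {Q : X → Set q} →
                 (∀ {x} → M x → Q x) → (∀ {x y} → Q x → Q y → Q (x ∨ y)) →
                 ∀ {x} → Joins M x → Q x
  Joins-closed M⊆Q Q-∨ [ m ]     = M⊆Q m
  Joins-closed M⊆Q Q-∨ (j ∨ᴶ k) = Q-∨ (Joins-closed M⊆Q Q-∨ j) (Joins-closed M⊆Q Q-∨ k)

  data JoinBelow {p : Level} (M : X → Set p) (x : X) : Set (a ⊔ˡ r ⊔ˡ p) where
    below : ∀ {y} → Joins M y → y ⊑ x → JoinBelow M x

  module _ {p : Level} {M : X → Set p} where

    JoinBelow-⊑ : ∀ {x y} → x ⊑ y → JoinBelow M x → JoinBelow M y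
    JoinBelow-⊑ x⊑y (below j z⊑x) = below j (⊑-trans z⊑x x⊑y)

    JoinBelow-∨ : ∀ {x y} → JoinBelow M x → JoinBelow M y → JoinBelow M (x ∨ y)
    JoinBelow-∨ (below j z⊑x) (below j′ z′⊑y) = below (j ∨ᴶ j′) (∨-mono z⊑x z′⊑y)

    JoinBelow-closed : ∀ {q} {Q : X → Set q} → (∀ {x y} → x ⊑ y → Q x → Q y) →
                       (∀ {x} → M x → Q x) → (∀ {x y} → Q x → Q y → Q (x ∨ y)) →
                       ∀ {x} → JoinBelow M x → Q x
    JoinBelow-closed Q-⊑ M⊆Q Q-∨ (below j y⊑x) = Q-⊑ y⊑x (Joins-closed M⊆Q Q-∨ j)

    module _ (M-∧ : ∀ {x y} → M x → M y → M (x ∧ y)) where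

      Joins-∧ : ∀ {x y} → Joins M x → Joins M y → JoinBelow M (x ∧ y)
      Joins-∧ [ m ] [ n ] = below [ M-∧ m n ] ⊑-refl
      Joins-∧ [ m ] (j ∨ᴶ k) =
        JoinBelow-⊑ (∧-distribˡ-∨ _ _ _) (JoinBelow-∨ (Joins-∧ [ m ] j) (Joins-∧ [ m ] k))
      Joins-∧ (j ∨ᴶ k) l =
        JoinBelow-⊑ (∧-distribʳ-∨ _ _ _) (JoinBelow-∨ (Joins-∧ j l) (Joins-∧ k l))

      JoinBelow-∧ : ∀ {x y} → JoinBelow M x → JoinBelow M y → JoinBelow M (x ∧ y)
      JoinBelow-∧ (below j z⊑x) (below j′ z′⊑y) = JoinBelow-⊑ (∧-mono z⊑x z′⊑y) (Joins-∧ j j′)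

module InformationOrder {ℓ : Level} (P₊ P₋ : FramePres ℓ) where
  open Bi P₊ P₋
  module I₊ = IdealLattice P₊
  module I₋ = IdealLattice P₋

  ⊑-refl : ∀ α → α ⊑ α
  ⊑-refl _ = (λ _ m → m) , (λ _ m → m)

  ⊑-trans : ∀ α β γ → α ⊑ β → β ⊑ γ → α ⊑ γ
  ⊑-trans _ _ _ (p₊ , p₋) (q₊ , q₋) = (λ b m → q₊ b (p₊ b m)) , (λ b m → q₋ b (p₋ b m))

  ⊔-mono : ∀ α β γ δ → α ⊑ β → γ ⊑ δ → (α ⊔ γ) ⊑ (β ⊔ δ)
  ⊔-mono α β γ δ (p₊ , p₋) (q₊ , q₋) =
    I₊.∪-mono (proj₁ α) (proj₁ β) (proj₁ γ) (proj₁ δ) p₊ q₊ ,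
    λ b (m , n) → p₋ b m , q₋ b n

  ⊓-mono : ∀ α β γ δ → α ⊑ β → γ ⊑ δ → (α ⊓ γ) ⊑ (β ⊓ δ)
  ⊓-mono α β γ δ (p₊ , p₋) (q₊ , q₋) =
    (λ b (m , n) → p₊ b m , q₊ b n) ,
    I₋.∪-mono (proj₂ α) (proj₂ β) (proj₂ γ) (proj₂ δ) p₋ q₋

  ⊓-distribˡ-⊔ : ∀ α β γ → ((α ⊓ β) ⊔ (α ⊓ γ)) ⊑ (α ⊓ (β ⊔ γ))
  ⊓-distribˡ-⊔ (α₊ , α₋) (β₊ , β₋) (γ₊ , γ₋) =
    proj₂ (I₊.∧-distribˡ-∨ α₊ β₊ γ₊) , proj₂ (I₋.∨-distribˡ-∧ α₋ β₋ γ₋)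

  ⊓-distribʳ-⊔ : ∀ α β γ → ((β ⊓ α) ⊔ (γ ⊓ α)) ⊑ ((β ⊔ γ) ⊓ α)
  ⊓-distribʳ-⊔ (α₊ , α₋) (β₊ , β₋) (γ₊ , γ₋) =
    proj₂ (I₊.∧-distribʳ-∨ α₊ β₊ γ₊) , proj₂ (I₋.∨-distribʳ-∧ α₋ β₋ γ₋)

  ⊔-distribˡ-⊓ : ∀ α β γ → ((α ⊔ β) ⊓ (α ⊔ γ)) ⊑ (α ⊔ (β ⊓ γ))
  ⊔-distribˡ-⊓ (α₊ , α₋) (β₊ , β₋) (γ₊ , γ₋) =
    proj₂ (I₊.∨-distribˡ-∧ α₊ β₊ γ₊) , proj₂ (I₋.∧-distribˡ-∨ α₋ β₋ γ₋)

  ⊔-distribʳ-⊓ : ∀ α β γ → ((β ⊔ α) ⊓ (γ ⊔ α)) ⊑ ((β ⊓ γ) ⊔ α)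
  ⊔-distribʳ-⊓ (α₊ , α₋) (β₊ , β₋) (γ₊ , γ₋) =
    proj₂ (I₊.∨-distribʳ-∧ α₊ β₊ γ₊) , proj₂ (I₋.∧-distribʳ-∨ α₋ β₋ γ₋)

  module Disjunctive =
    JoinsOfMeets _⊑_ (λ {α} → ⊑-refl α) (λ {α β γ} → ⊑-trans α β γ) _⊔_ _⊓_
      (λ {α β γ δ} → ⊔-mono α β γ δ) (λ {α β γ δ} → ⊓-mono α β γ δ) ⊓-distribˡ-⊔ ⊓-distribʳ-⊔
  -- The information order does not distinguish ⊔ from ⊓ in their distributive
  -- laws, so the same normal form holds with the two operations exchanged.
  module Conjunctive =
    JoinsOfMeets _⊑_ (λ {α} → ⊑-refl α) (λ {α β γ} → ⊑-trans α β γ) _⊓_ _⊔_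
      (λ {α β γ δ} → ⊓-mono α β γ δ) (λ {α β γ δ} → ⊔-mono α β γ δ) ⊔-distribˡ-⊓ ⊔-distribʳ-⊓

  module _ (R : B₊ → B₋ → Set ℓ) where

    ClMJ⇒disjunctive : ∀ {β} → ClMJ R β → Disjunctive.JoinBelow (ClM R) β
    ClMJ⇒disjunctive {β} (base r) = Disjunctive.below Disjunctive.[ base r ] (⊑-refl β)
    ClMJ⇒disjunctive (join a b) =
      Disjunctive.JoinBelow-∨ (ClMJ⇒disjunctive a) (ClMJ⇒disjunctive b)
    ClMJ⇒disjunctive (meet a b) =
      Disjunctive.JoinBelow-∧ meet (ClMJ⇒disjunctive a) (ClMJ⇒disjunctive b)

    ClMJ⇒conjunctive : ∀ {β} → ClMJ R β → Conjunctive.JoinBelow (ClJ R) β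
    ClMJ⇒conjunctive {β} (base r) = Conjunctive.below Conjunctive.[ base r ] (⊑-refl β)
    ClMJ⇒conjunctive (meet a b) =
      Conjunctive.JoinBelow-∨ (ClMJ⇒conjunctive a) (ClMJ⇒conjunctive b)
    ClMJ⇒conjunctive (join a b) =
      Conjunctive.JoinBelow-∧ join (ClMJ⇒conjunctive a) (ClMJ⇒conjunctive b)

    ClM⊆ClMJ : ∀ {β} → ClM R β → ClMJ R β
    ClM⊆ClMJ (base r)   = base r
    ClM⊆ClMJ (meet a b) = meet (ClM⊆ClMJ a) (ClM⊆ClMJ b)

    ClJ⊆ClMJ : ∀ {β} → ClJ R β → ClMJ R β
    ClJ⊆ClMJ (base r)   = base r
    ClJ⊆ClMJ (join a b) = join (ClJ⊆ClMJ a) (ClJ⊆ClMJ b)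

  ∈-upto : ∀ {S} β → S β → upto S β
  ∈-upto β s = β , s , ⊑-refl β , ⊑-refl β

module Forcing {ℓ : Level} (P₊ P₋ : FramePres ℓ) (A : Bi.Subset P₊ P₋) where
  open Bi P₊ P₋
  open InformationOrder P₊ P₋

  Forces₊ Forces₋ : Pair → Set (lsuc (lsuc ℓ))
  Forces₊ β = ∀ α → A α → proj₁ β L₊.⊆ proj₁ α → proj₂ α L₋.⊆ proj₂ β
  Forces₋ β = ∀ α → A α → proj₂ β L₋.⊆ proj₂ α → proj₁ α L₊.⊆ proj₁ β

  Forces₊-⊑ : ∀ β γ → β ⊑ γ → Forces₊ β → Forces₊ γ
  Forces₊-⊑ _ _ (p₊ , p₋) f α a γ₊⊆α₊ b m = p₋ b (f α a (λ c n → γ₊⊆α₊ c (p₊ c n)) b m)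

  Forces₋-⊑ : ∀ β γ → β ⊑ γ → Forces₋ β → Forces₋ γ
  Forces₋-⊑ _ _ (p₊ , p₋) f α a γ₋⊆α₋ b m = p₊ b (f α a (λ c n → γ₋⊆α₋ c (p₋ c n)) b m)

  Forces₊-⊔ : ∀ β γ → Forces₊ β → Forces₊ γ → Forces₊ (β ⊔ γ)
  Forces₊-⊔ _ _ f g α a le b m =
    f α a (λ c n → le c (L₊.gen (inj₁ n))) b m , g α a (λ c n → le c (L₊.gen (inj₂ n))) b m

  Forces₋-⊓ : ∀ β γ → Forces₋ β → Forces₋ γ → Forces₋ (β ⊓ γ)
  Forces₋-⊓ _ _ f g α a le b m =
    f α a (λ c n → le c (L₋.gen (inj₁ n))) b m , g α a (λ c n → le c (L₋.gen (inj₂ n))) b m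

  module _ (R : B₊ → B₋ → Set ℓ) where

    Forces₊-ClMJ : (∀ γ → ClM R γ → Forces₊ γ) → ∀ {β} → ClMJ R β → Forces₊ β
    Forces₊-ClMJ h t =
      Disjunctive.JoinBelow-closed {Q = Forces₊} (λ {β γ} → Forces₊-⊑ β γ) (h _)
        (λ {β γ} → Forces₊-⊔ β γ) (ClMJ⇒disjunctive R t)

    Forces₋-ClMJ : (∀ γ → ClJ R γ → Forces₋ γ) → ∀ {β} → ClMJ R β → Forces₋ β
    Forces₋-ClMJ h t =
      Conjunctive.JoinBelow-closed {Q = Forces₋} (λ {β γ} → Forces₋-⊑ β γ) (h _)
        (λ {β γ} → Forces₋-⊓ β γ) (ClMJ⇒conjunctive R t)

lemma12 : ∀ {ℓ : Level} (P₊ P₋ : FramePres ℓ)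
            (con₁ tot₁ : FramePres.B P₊ → FramePres.B P₋ → Set ℓ) →
            let open Bi.Conditions P₊ P₋ con₁ tot₁ in
            (λ²₊ ⇔ λ¹₊) × (λ²₋ ⇔ λ¹₋)
lemma12 P₊ P₋ con₁ tot₁ = mk⇔ λ²₊⇒λ¹₊ λ¹₊⇒λ²₊ , mk⇔ λ²₋⇒λ¹₋ λ¹₋⇒λ²₋
  where
  open Bi P₊ P₋
  open InformationOrder P₊ P₋
  open Conditions con₁ tot₁
  open Forcing P₊ P₋ (𝓓 (↓ (con₁ ∧∨)))

  λ²₊⇒λ¹₊ : λ²₊ → λ¹₊
  λ²₊⇒λ¹₊ λ² α β α∈𝓓 (β₀ , t , _ , β₀⊑β) =
    Forces₊-⊑ β₀ β β₀⊑β (Forces₊-ClMJ tot₁ (λ γ m α′ α′∈𝓓 → λ² α′ γ α′∈𝓓 (∈-upto γ m)) t) α α∈𝓓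

  λ¹₊⇒λ²₊ : λ¹₊ → λ²₊
  λ¹₊⇒λ²₊ λ¹ α β α∈𝓓 (β₀ , t , β≋β₀) = λ¹ α β α∈𝓓 (β₀ , ClM⊆ClMJ tot₁ t , β≋β₀)

  λ²₋⇒λ¹₋ : λ²₋ → λ¹₋
  λ²₋⇒λ¹₋ λ² α β α∈𝓓 (β₀ , t , _ , β₀⊑β) =
    Forces₋-⊑ β₀ β β₀⊑β (Forces₋-ClMJ tot₁ (λ γ m α′ α′∈𝓓 → λ² α′ γ α′∈𝓓 (∈-upto γ m)) t) α α∈𝓓

  λ¹₋⇒λ²₋ : λ¹₋ → λ²₋
  λ¹₋⇒λ²₋ λ¹ α β α∈𝓓 (β₀ , t , β≋β₀) = λ¹ α β α∈𝓓 (β₀ , ClJ⊆ClMJ tot₁ t , β≋β₀)
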